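{- Let $q$ be a positive integer, let $G$ be a graph and let $f\colon V(G)\to\mathbb{Z}_q$ be a star $q$-coloring of $G$. Then there exists an orientation $\vec{G}$ of $G$ such that $f$ is an out-neighbourhood injective homomorphism from $\vec{G}$ to $\vec{D}(K_q)$.
   Context: All graphs are simple and finite. A star $q$-coloring of a graph $G$ is a function $f\colon V(G)\to\mathbb{Z}_q$ such that (i) $f(u)\neq f(v)$ for every edge $uv$ of $G$, and (ii) there is no path $u,v,w,x$ in $G$ with $f(u)=f(w)$ and $f(v)=f(x)$. The complete graph $K_q$ has vertex set $\mathbb{Z}_q$, and $\vec{D}(K_q)$ is the directed graph on $\mathbb{Z}_q$ with arcs $(a,b)$ for all $a\neq b$. An orientation of $G$ is a directed graph obtained by assigning one direction to each edge of $G$. For directed graphs $\vec{G},\vec{H}$, an out-neighbourhood injective homomorphism from $\vec{G}$ to $\vec{H}$ is a map $\psi\colon V(\vec{G})\to V(\vec{H})$ such that for every vertex $v$ of $\vec{G}$, $\psi$ maps the out-neighbourhood $N^+_{\vec{G}}(v)$ injectively into the out-neighbourhood $N^+_{\vec{H}}(\psi(v))$. -}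

module Defs where

open import Data.Nat using (ℕ)
open import Data.Fin using (Fin)
open import Data.Bool using (Bool; true; false)
open import Data.Product using (_×_)
open import Data.Sum using (_⊎_)
open import Relation.Binary.PropositionalEquality using (_≡_; _≢_)
open import Relation.Nullary using (¬_)

record Graph (n : ℕ) : Set where
  field
    adj   : Fin n → Fin n → Bool
    sym   : ∀ u v → adj u v ≡ adj v u
    irrefl : ∀ v → adj v v ≡ false

open Graph public

Edge : ∀ {n} → Graph n → Fin n → Fin n → Set
Edge G u v = adj G u v ≡ true

IsPath4 : ∀ {n} → Graph n → Fin n → Fin n → Fin n → Fin n → Set
IsPath4 G u v w x =
  Edge G u v × Edge G v w × Edge G w x ×
  u ≢ v × u ≢ w × u ≢ x × v ≢ w × v ≢ x × w ≢ x

IsStarColoring : ∀ {n} (q : ℕ) → Graph n → (Fin n → Fin q) → Set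
IsStarColoring q G f =
  (∀ u v → Edge G u v → f u ≢ f v) ×
  (∀ u v w x → IsPath4 G u v w x → ¬ (f u ≡ f w × f v ≡ f x))

IsOrientation : ∀ {n} → Graph n → (Fin n → Fin n → Bool) → Set
IsOrientation G arc =
  (∀ u v → arc u v ≡ true → Edge G u v) ×
  (∀ u v → Edge G u v → arc u v ≡ true ⊎ arc v u ≡ true) ×
  (∀ u v → arc u v ≡ true → arc v u ≢ true)

-- Out-neighbourhood injective homomorphism from the digraph (Fin n, arc)
-- to D(K_q) (vertex set Fin q, arcs (a,b) for all a ≠ b):
-- for every v, ψ maps N⁺(v) into N⁺(ψ v) = {b | b ≠ ψ v}, injectively.
IsOutNbhdInjHomToDK : ∀ {n} (q : ℕ) → (Fin n → Fin n → Bool) → (Fin n → Fin q) → Set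
IsOutNbhdInjHomToDK q arc ψ =
  ∀ v →
    (∀ u → arc v u ≡ true → ψ u ≢ ψ v) ×
    (∀ u w → arc v u ≡ true → arc v w ≡ true → ψ u ≡ ψ w → u ≡ w)

{-# OPTIONS --safe #-}
module Submission where

open import Defs
open import Data.Nat using (ℕ; _<_)
open import Data.Fin using (Fin)
open import Data.Bool using (Bool; true)
open import Data.Product using (Σ; ∃; _×_; _,_; proj₁; proj₂)
open import Data.Sum using (_⊎_; inj₁; inj₂)
import Data.Sum as Sum
import Data.Bool.Properties as Bool
import Data.Fin as Fin
import Data.Fin.Properties as Fin
open import Relation.Binary using (Decidable; tri<; tri≈; tri>)
open import Relation.Binary.PropositionalEquality using (_≡_; _≢_; refl; trans; ≢-sym)
import Relation.Binary.PropositionalEquality as ≡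
open import Relation.Nullary using (¬_; Dec; yes; no; does; contradiction)
open import Relation.Nullary.Decidable using (dec-true; _×-dec_; _⊎-dec_; ¬?)

-- Orient an edge uv away from u unless u has another neighbour coloured like v;
-- then the out-neighbours of every vertex have distinct colours. A star colouring
-- never forbids both directions of an edge uv: the forbidding neighbours w of u
-- and x of v would span a path w,u,v,x coloured f v, f u, f v, f u.

private
  variable
    n q : ℕ

does-true⇒ : ∀ {A : Set} (a? : Dec A) → does a? ≡ true → A
does-true⇒ (yes a) _ = a

Edge-sym : (G : Graph n) {u v : Fin n} → Edge G u v → Edge G v u
Edge-sym G {u} {v} e = trans (Graph.sym G v u) e

Edge⇒≢ : (G : Graph n) {u v : Fin n} → Edge G u v → u ≢ v
Edge⇒≢ G {u} e refl = contradiction (trans (≡.sym (irrefl G u)) e) λ ()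

module OrientationAvoiding (G : Graph n) {B : Fin n → Fin n → Set} (B? : Decidable B)
                           (never-both : ∀ {u v} → Edge G u v → B u v → ¬ B v u) where

  -- Edges allowed in both directions are oriented along the order of Fin n.
  Arc : Fin n → Fin n → Set
  Arc u v = Edge G u v × ¬ B u v × (B v u ⊎ u Fin.< v)

  arc? : Decidable Arc
  arc? u v = (adj G u v Bool.≟ true) ×-dec ¬? (B? u v) ×-dec (B? v u ⊎-dec (u Fin.<? v))

  arc : Fin n → Fin n → Bool
  arc u v = does (arc? u v)

  Arc-total : ∀ {u v} → Edge G u v → Arc u v ⊎ Arc v u
  Arc-total {u} {v} e with B? u v | B? v u
  ... | yes buv | yes bvu = contradiction bvu (never-both e buv)
  ... | yes buv | no ¬bvu = inj₂ (Edge-sym G e , ¬bvu , inj₁ buv)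
  ... | no ¬buv | yes bvu = inj₁ (e , ¬buv , inj₁ bvu)
  ... | no ¬buv | no ¬bvu with Fin.<-cmp u v
  ...   | tri< u<v _ _ = inj₁ (e , ¬buv , inj₂ u<v)
  ...   | tri≈ _ u≡v _ = contradiction u≡v (Edge⇒≢ G e)
  ...   | tri> _ _ v<u = inj₂ (Edge-sym G e , ¬bvu , inj₂ v<u)

  Arc-asym : ∀ {u v} → Arc u v → ¬ Arc v u
  Arc-asym (_ , _ , inj₁ bvu) (_ , ¬bvu , _)     = ¬bvu bvu
  Arc-asym (_ , ¬buv , _)     (_ , _ , inj₁ buv) = ¬buv buv
  Arc-asym (_ , _ , inj₂ u<v) (_ , _ , inj₂ v<u) = Fin.<-asym u<v v<u

  arc-orientation : IsOrientation G arc
  arc-orientation =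
      (λ u v a → proj₁ (does-true⇒ (arc? u v) a))
    , (λ u v e → Sum.map (dec-true (arc? u v)) (dec-true (arc? v u)) (Arc-total e))
    , (λ u v a b → Arc-asym (does-true⇒ (arc? u v) a) (does-true⇒ (arc? v u) b))

  arc-avoids : ∀ u v → arc u v ≡ true → ¬ B u v
  arc-avoids u v a = proj₁ (proj₂ (does-true⇒ (arc? u v) a))

Clash : Graph n → (Fin n → Fin q) → Fin n → Fin n → Set
Clash G f u v = ∃ λ w → Edge G u w × w ≢ v × f w ≡ f v

clash? : (G : Graph n) (f : Fin n → Fin q) → Decidable (Clash G f)
clash? G f u v = Fin.any? λ w →
  (adj G u w Bool.≟ true) ×-dec ¬? (w Fin.≟ v) ×-dec (f w Fin.≟ f v)

star⇒¬clash-both : (G : Graph n) (f : Fin n → Fin q) → IsStarColoring q G f →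
                   ∀ {u v} → Edge G u v → Clash G f u v → ¬ Clash G f v u
star⇒¬clash-both G f (proper , no-bicoloured-path)
                 e (w , uw , w≢v , fw≡fv) (x , vx , x≢u , fx≡fu) =
  no-bicoloured-path w _ _ x
    ( Edge-sym G uw , e , vx
    , ≢-sym (Edge⇒≢ G uw) , w≢v , w≢x , Edge⇒≢ G e , ≢-sym x≢u , Edge⇒≢ G vx )
    (fw≡fv , ≡.sym fx≡fu)
  where
  w≢x : w ≢ x
  w≢x refl = proper _ w vx (≡.sym fw≡fv)

clash-free⇒outNbhdInjHom : (G : Graph n) (f : Fin n → Fin q) (arc : Fin n → Fin n → Bool) →
                           (∀ u v → Edge G u v → f u ≢ f v) →
                           (∀ u v → arc u v ≡ true → Edge G u v) →
                           (∀ u v → arc u v ≡ true → ¬ Clash G f u v) →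
                           IsOutNbhdInjHomToDK q arc f
clash-free⇒outNbhdInjHom G f arc proper arc⇒edge clash-free v =
  (λ u a fu≡fv → proper v u (arc⇒edge v u a) (≡.sym fu≡fv)) , injective
  where
  injective : ∀ u w → arc v u ≡ true → arc v w ≡ true → f u ≡ f w → u ≡ w
  injective u w a b fu≡fw with u Fin.≟ w
  ... | yes u≡w = u≡w
  ... | no u≢w  = contradiction (w , arc⇒edge v w b , ≢-sym u≢w , ≡.sym fu≡fw) (clash-free v u a)

theorem6 : (q : ℕ) → 0 < q → (n : ℕ) (G : Graph n) (f : Fin n → Fin q) →
    IsStarColoring q G f →
    Σ (Fin n → Fin n → Bool) (λ arc → IsOrientation G arc × IsOutNbhdInjHomToDK q arc f)
theorem6 q _ n G f star =
  arc , arc-orientation , clash-free⇒outNbhdInjHom G f arc (proj₁ star) (proj₁ arc-orientation) arc-avoids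
  where open OrientationAvoiding G (clash? G f) (star⇒¬clash-both G f star)
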